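{- For all $r,n\ge1$ and every $g=(z,\pi)\in G_{r,n}$, \[csign_F(g)=csign_F((0,\pi))\,csign_F((z,id)),\] where $0=(0,\dots,0)$ and $id$ is the identity of $S_n$.
   Context: $G_{r,n}$ is the set of pairs $g=(z,\pi)$ with $z\in\{0,\dots,r-1\}^n$, $\pi\in S_n$ (the wreath product $C_r\wr S_n$). Friends order $F$ on letters $i^{[c]}$: $1^{[r-1]}<\dots<1^{[0]}<2^{[r-1]}<\dots<2^{[0]}<\dots<n^{[r-1]}<\dots<n^{[0]}$. $inv_F(g)=|\{i<j:\pi(i)^{[z_i]}>_F\pi(j)^{[z_j]}\}|$, $csum(g)=\sum_i z_i$, $csign_F(g)=(-1)^{inv_F(g)+csum(g)}$. -}

module Defs where

open import Data.Nat using (ℕ; zero; suc; _+_)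
open import Data.Fin using (Fin; toℕ)
open import Data.Fin.Properties using (_<?_; _≟_)
open import Data.List using (List; length; filter; allFin; map; cartesianProduct)
open import Data.Nat.ListAction using (sum)
open import Data.Product using (_×_; _,_; proj₁; proj₂)
open import Data.Sum using (_⊎_)
open import Relation.Binary.PropositionalEquality using (_≡_)
open import Relation.Nullary using (Dec; yes; no; _×-dec_; _⊎-dec_)
open import Data.Integer using (ℤ; -1ℤ; 1ℤ; _*_)
open import Data.Fin.Permutation using (Permutation′; _⟨$⟩ʳ_)

-- An element g = (z , π) of G_{r,n} = C_r ≀ S_n.
-- z i ∈ {0,…,r-1} is the colour of position i; π is a permutation of {1..n}
-- (encoded 0-indexed as Fin n).
record G (r n : ℕ) : Set where
  constructor _,_
  field
    col  : Fin n → Fin r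
    perm : Permutation′ n
open G public

Letter : ℕ → ℕ → Set
Letter r n = Fin n × Fin r

_<F_ : ∀ {r n} → Letter r n → Letter r n → Set
(a , c) <F (b , d) = (a Data.Fin.< b) ⊎ ((a ≡ b) × (d Data.Fin.< c))

_<F?_ : ∀ {r n} → (x y : Letter r n) → Dec (x <F y)
(a , c) <F? (b , d) = (a <? b) ⊎-dec ((a ≟ b) ×-dec (d <? c))

letter : ∀ {r n} → G r n → Fin n → Letter r n
letter g i = (perm g ⟨$⟩ʳ i , col g i)

invF : ∀ {r n} → G r n → ℕ
invF {r} {n} g =
  length (filter (λ p → (proj₁ p <? proj₂ p) ×-dec (letter g (proj₂ p) <F? letter g (proj₁ p)))
                 (cartesianProduct (allFin n) (allFin n)))

csum : ∀ {r n} → G r n → ℕ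
csum {r} {n} g = sum (map (λ i → toℕ (col g i)) (allFin n))

signPow : ℕ → ℤ
signPow zero = 1ℤ
signPow (suc k) = -1ℤ * signPow k

csignF : ∀ {r n} → G r n → ℤ
csignF g = signPow (invF g + csum g)

{-# OPTIONS --safe #-}
-- Two positions i < j can only tie in the friends order if π i = π j, which injectivity
-- of π rules out; so inv_F(z , π) is the colour-blind inversion number of π. Hence
-- inv_F(z , π) = inv_F(0 , π) and inv_F(z , id) = 0, while csum does not see π and
-- vanishes on the zero colouring. The sign (-1)^k turns the sum inv_F + csum into a
-- product, and the two factors are csign_F(0 , π) and csign_F(z , id).
module Submission where

open import Defs
open import Data.Nat using (ℕ; suc)
open import Data.Fin using (Fin; zero)
open import Data.Integer using (_*_)
open import Data.Fin.Permutation using (Permutation′; id)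
open import Relation.Binary.PropositionalEquality using (_≡_)

open import Data.Nat using (_+_)
open import Data.Integer using (-1ℤ)
import Data.Integer.Properties as ℤ
open import Data.Fin using (_<_)
import Data.Fin.Properties as Fin
open import Data.Fin.Permutation using (_⟨$⟩ʳ_)
open import Data.List using (List; []; _∷_; length; map; allFin; cartesianProduct)
open import Data.List.Properties using (filter-≐; filter-none)
import Data.List.Relation.Unary.All as All
open import Data.Nat.ListAction using (sum)
open import Data.Product using (_×_; _,_)
open import Data.Sum using (inj₁; inj₂)
open import Function.Base using (_∘_)
open import Function.Bundles using (Injection)
open import Function.Properties.Inverse using (↔⇒↣)
open import Relation.Nullary using (¬_; contradiction)
open import Relation.Binary.PropositionalEquality
  using (_≢_; refl; sym; cong; cong₂; module ≡-Reasoning)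

signPow-+ : ∀ m n → signPow (m + n) ≡ signPow m * signPow n
signPow-+ 0       n = sym (ℤ.*-identityˡ (signPow n))
signPow-+ (suc m) n = begin
  -1ℤ * signPow (m + n)          ≡⟨ cong (-1ℤ *_) (signPow-+ m n) ⟩
  -1ℤ * (signPow m * signPow n)  ≡⟨ ℤ.*-assoc -1ℤ (signPow m) (signPow n) ⟨
  -1ℤ * signPow m * signPow n    ∎
  where open ≡-Reasoning

csignF-split : ∀ {r n} (g : G r n) → csignF g ≡ signPow (invF g) * signPow (csum g)
csignF-split g = signPow-+ (invF g) (csum g)

letter-<F⇒perm-< : ∀ {r n} (g : G r n) {i j : Fin n} → i ≢ j →
                   letter g i <F letter g j → perm g ⟨$⟩ʳ i < perm g ⟨$⟩ʳ j
letter-<F⇒perm-< g i≢j (inj₁ πi<πj)      = πi<πj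
letter-<F⇒perm-< g i≢j (inj₂ (πi≡πj , _)) =
  contradiction (Injection.injective (↔⇒↣ (perm g)) πi≡πj) i≢j

InversionF : ∀ {r n} → G r n → Fin n × Fin n → Set
InversionF g (i , j) = i < j × letter g j <F letter g i

module _ {r n : ℕ} where

  pairs : List (Fin n × Fin n)
  pairs = cartesianProduct (allFin n) (allFin n)

  recolour : (z z′ : Fin n → Fin r) (π : Permutation′ n) (p : Fin n × Fin n) →
             InversionF (z , π) p → InversionF (z′ , π) p
  recolour z z′ π (i , j) (i<j , j<Fi) =
    i<j , inj₁ (letter-<F⇒perm-< (z , π) (Fin.<⇒≢ i<j ∘ sym) j<Fi)

  invF-recolour : (z z′ : Fin n → Fin r) (π : Permutation′ n) →
                  invF (z , π) ≡ invF (z′ , π)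
  invF-recolour z z′ π =
    cong length (filter-≐ _ _ (recolour z z′ π _ , recolour z′ z π _) pairs)

  noInversionF-id : (z : Fin n → Fin r) (p : Fin n × Fin n) → ¬ InversionF (z , id) p
  noInversionF-id z (i , j) (i<j , j<Fi) =
    Fin.<-asym i<j (letter-<F⇒perm-< (z , id) (Fin.<⇒≢ i<j ∘ sym) j<Fi)

  invF-id : (z : Fin n → Fin r) → invF (z , id) ≡ 0
  invF-id z = cong length (filter-none _ (All.universal (noInversionF-id z) pairs))

sum-map-const-0 : ∀ {a} {A : Set a} (xs : List A) → sum (map (λ _ → 0) xs) ≡ 0
sum-map-const-0 []       = refl
sum-map-const-0 (_ ∷ xs) = sum-map-const-0 xs

csignF-uncoloured : ∀ {r n} (π : Permutation′ n) →
                    csignF {suc r} ((λ _ → zero) , π) ≡ signPow (invF {suc r} ((λ _ → zero) , π))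
csignF-uncoloured {r} {n} π = begin
  csignF g                               ≡⟨ csignF-split g ⟩
  signPow (invF g) * signPow (csum g)    ≡⟨ cong (λ k → signPow (invF g) * signPow k)
                                                 (sum-map-const-0 (allFin n)) ⟩
  signPow (invF g) * signPow 0           ≡⟨ ℤ.*-identityʳ (signPow (invF g)) ⟩
  signPow (invF g)                       ∎
  where
  open ≡-Reasoning
  g : G (suc r) n
  g = (λ _ → zero) , π

csignF-unpermuted : ∀ {r n} (z : Fin n → Fin r) → csignF (z , id) ≡ signPow (csum (z , id))
csignF-unpermuted z = cong (λ k → signPow (k + csum (z , id))) (invF-id z)

mainTheorem14 : (r n : ℕ) (z : Fin (suc n) → Fin (suc r)) (π : Permutation′ (suc n)) →
    csignF {suc r} {suc n} (z , π)
      ≡ csignF {suc r} {suc n} ((λ _ → zero) , π) * csignF {suc r} {suc n} (z , id)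
mainTheorem14 r n z π = begin
  csignF (z , π)                                      ≡⟨ csignF-split (z , π) ⟩
  signPow (invF (z , π)) * signPow (csum (z , π))     ≡⟨ cong (λ k → signPow k * signPow (csum (z , id)))
                                                             (invF-recolour z 0ᶜ π) ⟩
  signPow (invF (0ᶜ , π)) * signPow (csum (z , id))   ≡⟨ cong₂ _*_ (csignF-uncoloured {r} π)
                                                               (csignF-unpermuted z) ⟨
  csignF (0ᶜ , π) * csignF (z , id)                   ∎
  where
  open ≡-Reasoning
  0ᶜ : Fin (suc n) → Fin (suc r)
  0ᶜ _ = zero
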